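{- Let $\lambda/\mu$ and $\alpha/\beta$ be skew partitions of the same size. Then: (i) $S:\mathrm{RSYT}(\lambda/\mu,\alpha/\beta)\to\mathrm{RSYT}(\alpha/\beta,\lambda/\mu)$ is a bijection, and applying $S$ twice gives the identity; (ii) $S$ restricts to a bijection $\mathrm{SSYT}(\lambda/\mu,\alpha/\beta)\to\mathrm{RSYTL}(\alpha/\beta,\lambda/\mu)$ (with inverse $S$); (iii) $S$ restricts to a bijection $\mathrm{SSYTL}(\lambda/\mu,\alpha/\beta)\to\mathrm{SSYTL}(\alpha/\beta,\lambda/\mu)$ (with inverse $S$).
   Context: A row-standard tableau of skew shape is a filling of the boxes with positive integers weakly increasing along each row (no column condition). $\mathrm{RSYT}(\lambda/\mu,\alpha/\beta)$ is the set of row-standard tableaux $t$ of shape $\lambda/\mu$ with $\beta+\mathrm{cont}(t)=\alpha$; $\mathrm{SSYT}(\lambda/\mu,\alpha/\beta)$ is its subset of semistandard (columns strictly increasing) tableaux. $u(\beta)$ is the tableau of shape $\beta$ whose entries in row $j$ all equal $j$. The word of a tableau is read along rows left to right, starting with the highest-numbered row; the word of the pair $(t,u(\beta))$ is $\mathrm w(t)\mathrm w(u(\beta))$; it is latticed if for every $k\ge1$ every suffix contains at least as many $k$'s as $(k+1)$'s. $\mathrm{RSYTL}(\lambda/\mu,\alpha/\beta)=\{t\in\mathrm{RSYT}(\lambda/\mu,\alpha/\beta): (t,u(\beta))\text{ latticed}\}$ and $\mathrm{SSYTL}(\lambda/\mu,\alpha/\beta)=\mathrm{RSYTL}(\lambda/\mu,\alpha/\beta)\cap\mathrm{SSYT}(\lambda/\mu,\alpha/\beta)$.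 For $t\in\mathrm{RSYT}(\lambda/\mu,\alpha/\beta)$, $S(t)$ is the row-standard tableau of shape $\alpha/\beta$ having, in row $a$, one entry $k$ for each entry $a$ in row $k$ of $t$ (arranged in weakly increasing order). -}

module Defs where

open import Data.Nat using (ℕ; zero; suc; _+_; _∸_; _≤_; _<_)
open import Data.Nat.Properties using (_≟_)
open import Data.List using (List; []; _∷_; length; map; filter; concat; reverse; replicate; upTo; drop; _++_)
open import Data.List.Relation.Unary.All using (All)
open import Data.List.Relation.Unary.Linked using (Linked)
open import Data.List.Relation.Binary.Pointwise using (Pointwise)
open import Data.Nat.ListAction using (sum)
open import Data.Maybe using (Maybe; just; nothing)
open import Data.Product using (_×_; Σ)
open import Relation.Binary.PropositionalEquality using (_≡_)

-- CONVENTIONS: rows are indexed from 0 (row 0 = paper's row 1),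
-- and tableau entries are natural numbers with entry k standing for the paper's
-- positive integer k+1.  A partition is a list of row lengths (trailing zeros
-- allowed); row i of a partition beyond its length has length 0.

at : List ℕ → ℕ → ℕ
at []       _       = 0
at (x ∷ _)  zero    = x
at (_ ∷ xs) (suc i) = at xs i

nth : {A : Set} → List A → ℕ → Maybe A
nth []       _       = nothing
nth (x ∷ _)  zero    = just x
nth (_ ∷ xs) (suc i) = nth xs i

IsPartition : List ℕ → Set
IsPartition λ′ = ∀ i → at λ′ (suc i) ≤ at λ′ i

IsSkew : List ℕ → List ℕ → Set
IsSkew λ′ μ = IsPartition λ′ × IsPartition μ × (∀ i → at μ i ≤ at λ′ i)

rowLens : List ℕ → List ℕ → List ℕ
rowLens λ′ μ = map (λ i → at λ′ i ∸ at μ i) (upTo (length λ′))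

size : List ℕ → List ℕ → ℕ
size λ′ μ = sum (rowLens λ′ μ)

-- A tableau is the list of its rows (row i lists the entries of row i of
-- λ/μ from left to right).
Tableau : Set
Tableau = List (List ℕ)

HasShape : List ℕ → List ℕ → Tableau → Set
HasShape λ′ μ t = Pointwise (λ r n → length r ≡ n) t (rowLens λ′ μ)

count : ℕ → List ℕ → ℕ
count k xs = length (filter (k ≟_) xs)

cont : Tableau → ℕ → ℕ
cont t k = sum (map (count k) t)

RowStandard : Tableau → Set
RowStandard t = All (Linked _≤_) t

RSYT : List ℕ → List ℕ → List ℕ → List ℕ → Tableau → Set
RSYT λ′ μ α β t =
  HasShape λ′ μ t × RowStandard t × (∀ k → at β k + cont t k ≡ at α k)

entry : List ℕ → Tableau → ℕ → ℕ → Maybe ℕ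
entry μ t i j with nth t i
... | nothing = nothing
... | just r  = if′ (at μ i ≤? j)
  where
    open import Relation.Nullary using (Dec; yes; no)
    open import Data.Nat using (_≤?_)
    if′ : Dec (at μ i ≤ j) → Maybe ℕ
    if′ (yes _) = nth r (j ∸ at μ i)
    if′ (no _)  = nothing

ColumnStrict : List ℕ → Tableau → Set
ColumnStrict μ t = ∀ i i′ j x y → i < i′ →
  entry μ t i j ≡ just x → entry μ t i′ j ≡ just y → x < y

SSYT : List ℕ → List ℕ → List ℕ → List ℕ → Tableau → Set
SSYT λ′ μ α β t = RSYT λ′ μ α β t × ColumnStrict μ t

word : Tableau → List ℕ
word t = concat (reverse t)

u : List ℕ → Tableau
u β = map (λ j → replicate (at β j) j) (upTo (length β))

Latticed : List ℕ → Set
Latticed w = ∀ k n → count (suc k) (drop n w) ≤ count k (drop n w)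

RSYTL : List ℕ → List ℕ → List ℕ → List ℕ → Tableau → Set
RSYTL λ′ μ α β t = RSYT λ′ μ α β t × Latticed (word t ++ word (u β))

SSYTL : List ℕ → List ℕ → List ℕ → List ℕ → Tableau → Set
SSYTL λ′ μ α β t = RSYTL λ′ μ α β t × ColumnStrict μ t

-- S(t), as a tableau of shape α/β (α is the outer shape of the target):
-- row a contains one entry k for each entry a in row k of t, weakly increasing.
rowsWithIndex : ℕ → Tableau → List (ℕ × List ℕ)
rowsWithIndex _ []       = []
rowsWithIndex k (r ∷ rs) = (k Data.Product., r) ∷ rowsWithIndex (suc k) rs

Srow : Tableau → ℕ → List ℕ
Srow t a = concat (map (λ p → replicate (count a (Data.Product.proj₂ p)) (Data.Product.proj₁ p)) (rowsWithIndex 0 t))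

S : List ℕ → Tableau → Tableau
S α t = map (Srow t) (upTo (length α))

BijOn : {A : Set} → (A → Set) → (A → Set) → (A → A) → (A → A) → Set
BijOn P Q f g =
  (∀ x → P x → Q (f x)) × (∀ y → Q y → P (g y)) ×
  (∀ x → P x → g (f x) ≡ x) × (∀ y → Q y → f (g y) ≡ y)

-- Row a of S(t) records, for every row k of t, how often a occurs there, so t and S(t)
-- encode the same matrix of multiplicities transposed; as sorted rows are determined by
-- their multisets, S ∘ S = id.
--
-- Write c k a for the number of entries < a in row k of t. The part of the word of
-- (S(t), u(μ)) from the start of row a of S(t) to the end contains c k (a+1) + μ k letters k,
-- so, the rows of S(t) being sorted, the pair is latticed iff
-- c (k+1) (a+1) + μ (k+1) ≤ c k a + μ k for all k and a. Row k+1 of the skew shape starts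
-- μ k − μ (k+1) columns before row k, and for two sorted rows that shifted count inequality
-- is exactly strictness of the columns they share. Column strictness between adjacent rows
-- gives column strictness of a skew tableau, since its columns are intervals of rows.
-- Hence t is semistandard iff (S(t), u(μ)) is latticed, which together with S ∘ S = id
-- yields (ii) and (iii).

module Submission where

open import Defs
open import Data.Nat using (ℕ; zero; suc; _+_; _∸_; _≤_; _<_; z≤n; s≤s; s≤s⁻¹; s<s⁻¹; z<s)
open import Data.Nat.Properties
open import Data.List using (List; []; _∷_; length; map; filter; concat; reverse; replicate; upTo; drop; _++_; applyUpTo; _∷ʳ_)
open import Data.List.Properties
  using (filter-accept; filter-reject; filter-++; length-++; length-map; length-replicate; length-upTo; length-applyUpTo;
         ++-assoc; ++-identityʳ; map-++; map-cong; map-replicate; map-upTo; applyUpTo-∷ʳ; reverse-++; unfold-reverse; concat-++)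
open import Data.List.Relation.Unary.All as All using (All; []; _∷_)
open import Data.List.Relation.Unary.All.Properties as All using ()
open import Data.List.Relation.Unary.AllPairs as AllPairs using (AllPairs; []; _∷_)
open import Data.List.Relation.Unary.AllPairs.Properties as AllPairs using ()
open import Data.List.Relation.Unary.Linked.Properties using (Linked⇒AllPairs; AllPairs⇒Linked)
open import Data.List.Relation.Binary.Pointwise as Pointwise using (Pointwise; []; _∷_; Pointwise-length)
open import Data.Maybe using (just; nothing)
open import Data.Product using (_×_; _,_; proj₁; proj₂; ∃-syntax)
open import Data.Sum using (inj₁; inj₂)
open import Data.Empty using (⊥-elim)
open import Function using (id; _∘′_; _⇔_; mk⇔; Equivalence)
open import Function.Properties.Equivalence using () renaming (trans to ⇔-trans; sym to ⇔-sym)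
open import Relation.Nullary using (Dec; yes; no)
open import Relation.Binary.PropositionalEquality
open import Relation.Binary.Definitions using (tri<; tri≈; tri>)

count-∷-≡ : ∀ k xs → count k (k ∷ xs) ≡ suc (count k xs)
count-∷-≡ k xs = cong length (filter-accept (k ≟_) {x = k} {xs = xs} refl)

count-∷-≢ : ∀ {k x} xs → k ≢ x → count k (x ∷ xs) ≡ count k xs
count-∷-≢ {k} {x} xs k≢x = cong length (filter-reject (k ≟_) {x = x} {xs = xs} k≢x)

count-∷-≥ : ∀ k x xs → count k xs ≤ count k (x ∷ xs)
count-∷-≥ k x xs with k ≟ x
... | yes refl = ≤-trans (n≤1+n _) (≤-reflexive (sym (count-∷-≡ k xs)))
... | no k≢x = ≤-reflexive (sym (count-∷-≢ xs k≢x))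

count-++ : ∀ k xs ys → count k (xs ++ ys) ≡ count k xs + count k ys
count-++ k xs ys = trans (cong length (filter-++ (k ≟_) xs ys)) (length-++ (filter (k ≟_) xs))

count-replicate-≡ : ∀ k n → count k (replicate n k) ≡ n
count-replicate-≡ k zero    = refl
count-replicate-≡ k (suc n) = trans (count-∷-≡ k (replicate n k)) (cong suc (count-replicate-≡ k n))

count-≡0 : ∀ {k} xs → All (k ≢_) xs → count k xs ≡ 0
count-≡0 []       []              = refl
count-≡0 (x ∷ xs) (k≢x ∷ k≢xs) = trans (count-∷-≢ xs k≢x) (count-≡0 xs k≢xs)

count-replicate-≢ : ∀ {k j} n → k ≢ j → count k (replicate n j) ≡ 0
count-replicate-≢ n k≢j = count-≡0 (replicate n _) (All.replicate⁺ n k≢j)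

count-map-suc : ∀ k xs → count (suc k) (map suc xs) ≡ count k xs
count-map-suc k []       = refl
count-map-suc k (x ∷ xs) with k ≟ x
... | yes refl = trans (count-∷-≡ (suc k) (map suc xs)) (trans (cong suc (count-map-suc k xs)) (sym (count-∷-≡ k xs)))
... | no k≢x   = trans (count-∷-≢ (map suc xs) (k≢x ∘′ suc-injective))
                       (trans (count-map-suc k xs) (sym (count-∷-≢ xs k≢x)))

count-zero-map-suc : ∀ xs → count 0 (map suc xs) ≡ 0
count-zero-map-suc xs = count-≡0 (map suc xs) (All.map⁺ (All.universal (λ _ ()) xs))

count-drop-≤ : ∀ k n xs → count k (drop n xs) ≤ count k xs
count-drop-≤ k zero    xs       = ≤-refl
count-drop-≤ k (suc n) []       = ≤-refl
count-drop-≤ k (suc n) (x ∷ xs) = ≤-trans (count-drop-≤ k n xs) (count-∷-≥ k x xs)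

All-tabulate-count : ∀ {P : ℕ → Set} xs → (∀ x → 0 < count x xs → P x) → All P xs
All-tabulate-count []       _ = []
All-tabulate-count (x ∷ xs) h =
  h x (subst (0 <_) (sym (count-∷-≡ x xs)) z<s) ∷ All-tabulate-count xs (λ y 0<c → h y (≤-trans 0<c (count-∷-≥ y x xs)))

countBelow : ℕ → List ℕ → ℕ
countBelow a []       = 0
countBelow a (x ∷ xs) with x <? a
... | yes _ = suc (countBelow a xs)
... | no  _ = countBelow a xs

countBelow-suc : ∀ a xs → countBelow (suc a) xs ≡ count a xs + countBelow a xs
countBelow-suc a []       = refl
countBelow-suc a (x ∷ xs) with x <? suc a | x <? a
... | yes _ | yes x<a =
  trans (cong suc (countBelow-suc a xs))
        (trans (sym (+-suc _ _)) (cong (_+ _) (sym (count-∷-≢ xs (λ a≡x → <-irrefl (sym a≡x) x<a)))))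
... | yes x<1+a | no x≮a with refl ← ≤-antisym (s≤s⁻¹ x<1+a) (≮⇒≥ x≮a) =
  trans (cong suc (countBelow-suc x xs)) (cong (_+ countBelow x xs) (sym (count-∷-≡ x xs)))
... | no x≮1+a | yes x<a = ⊥-elim (x≮1+a (m<n⇒m<1+n x<a))
... | no x≮1+a | no _ =
  trans (countBelow-suc a xs) (cong (_+ _) (sym (count-∷-≢ xs (λ a≡x → x≮1+a (subst (_< suc a) a≡x (n<1+n a))))))

countBelow-all : ∀ {a} xs → All (_< a) xs → countBelow a xs ≡ length xs
countBelow-all {a} []       []            = refl
countBelow-all {a} (x ∷ xs) (x<a ∷ xs<a) with x <? a
... | yes _  = cong suc (countBelow-all xs xs<a)
... | no x≮a = ⊥-elim (x≮a x<a)

countBelow-none : ∀ {a} xs → All (a ≤_) xs → countBelow a xs ≡ 0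
countBelow-none {a} []       []            = refl
countBelow-none {a} (x ∷ xs) (a≤x ∷ a≤xs) with x <? a
... | yes x<a = ⊥-elim (<-irrefl refl (<-≤-trans x<a a≤x))
... | no _    = countBelow-none xs a≤xs

countBelow-∷-< : ∀ {a y} ys → y < a → countBelow a (y ∷ ys) ≡ suc (countBelow a ys)
countBelow-∷-< {a} {y} ys y<a with y <? a
... | yes _  = refl
... | no y≮a = ⊥-elim (y≮a y<a)

countBelow-∷-≤ : ∀ a y ys → countBelow a (y ∷ ys) ≤ suc (countBelow a ys)
countBelow-∷-≤ a y ys with y <? a
... | yes _ = ≤-refl
... | no  _ = n≤1+n _

Sorted : List ℕ → Set
Sorted = AllPairs _≤_

sorted-map-suc : ∀ {xs} → Sorted xs → Sorted (map suc xs)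
sorted-map-suc s = AllPairs.map⁺ (AllPairs.map s≤s s)

sorted-replicate-zero-++ : ∀ n {ys} → Sorted ys → Sorted (replicate n 0 ++ ys)
sorted-replicate-zero-++ zero    s = s
sorted-replicate-zero-++ (suc n) s = All.universal (λ _ → z≤n) _ ∷ sorted-replicate-zero-++ n s

All-≢-of-< : ∀ {k y ys} → k < y → All (y ≤_) ys → All (k ≢_) ys
All-≢-of-< k<y = All.map (λ y≤z k≡z → <-irrefl k≡z (<-≤-trans k<y y≤z))

count-∷-< : ∀ {k y} ys → k < y → All (y ≤_) ys → count k (y ∷ ys) ≡ 0
count-∷-< ys k<y y≤ys = count-≡0 (_ ∷ ys) (All-≢-of-< k<y (≤-refl ∷ y≤ys))

count-∷-cancel : ∀ x xs ys → (∀ k → count k (x ∷ xs) ≡ count k (x ∷ ys)) → ∀ k → count k xs ≡ count k ys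
count-∷-cancel x xs ys h k with k ≟ x
... | yes refl = suc-injective (trans (sym (count-∷-≡ k xs)) (trans (h k) (count-∷-≡ k ys)))
... | no k≢x   = trans (sym (count-∷-≢ xs k≢x)) (trans (h k) (count-∷-≢ ys k≢x))

sorted-unique : ∀ {xs ys} → Sorted xs → Sorted ys → (∀ k → count k xs ≡ count k ys) → xs ≡ ys
sorted-unique {[]}     {[]}     _ _ h = refl
sorted-unique {[]}     {y ∷ ys} _ _ h with () ← trans (h y) (count-∷-≡ y ys)
sorted-unique {x ∷ xs} {[]}     _ _ h with () ← trans (sym (count-∷-≡ x xs)) (h x)
sorted-unique {x ∷ xs} {y ∷ ys} (x≤xs ∷ sx) (y≤ys ∷ sy) h with <-cmp x y
... | tri< x<y _ _ with () ← trans (sym (count-∷-≡ x xs)) (trans (h x) (count-∷-< ys x<y y≤ys))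
... | tri> _ _ y<x with () ← trans (sym (count-∷-≡ y ys)) (trans (sym (h y)) (count-∷-< xs y<x x≤xs))
... | tri≈ _ refl _ = cong (x ∷_) (sorted-unique sx sy (count-∷-cancel x xs ys h))

sorted-cut : ∀ {xs} → Sorted xs → ∀ k →
  ∃[ m ] m ≤ length xs × count k (drop m xs) ≡ 0 × count (suc k) (drop m xs) ≡ count (suc k) xs
sorted-cut {[]}     _ k = 0 , z≤n , refl , refl
sorted-cut {x ∷ xs} (x≤xs ∷ sx) k with x ≤? k
... | yes x≤k = let m , m≤ , no-k , all-suc-k = sorted-cut sx k in
  suc m , s≤s m≤ , no-k , trans all-suc-k (sym (count-∷-≢ xs (λ k+1≡x → <-irrefl (sym k+1≡x) (s≤s x≤k))))
... | no x≰k  = 0 , z≤n , count-∷-< xs (≰⇒> x≰k) x≤xs , refl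

-- Rows and reading word of S(t)

rowOf : Tableau → ℕ → List ℕ
rowOf []       _       = []
rowOf (r ∷ _)  zero    = r
rowOf (_ ∷ rs) (suc i) = rowOf rs i

SrowFrom : ℕ → Tableau → ℕ → List ℕ
SrowFrom k t a = concat (map (λ p → replicate (count a (proj₂ p)) (proj₁ p)) (rowsWithIndex k t))

SrowFrom-suc : ∀ k t a → SrowFrom (suc k) t a ≡ map suc (SrowFrom k t a)
SrowFrom-suc k []       a = refl
SrowFrom-suc k (r ∷ rs) a = begin
  replicate (count a r) (suc k) ++ SrowFrom (suc (suc k)) rs a
    ≡⟨ cong₂ _++_ (sym (map-replicate suc (count a r) k)) (SrowFrom-suc (suc k) rs a) ⟩
  map suc (replicate (count a r) k) ++ map suc (SrowFrom (suc k) rs a)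
    ≡⟨ sym (map-++ suc (replicate (count a r) k) _) ⟩
  map suc (replicate (count a r) k ++ SrowFrom (suc k) rs a) ∎
  where open ≡-Reasoning

Srow-∷ : ∀ r rs a → Srow (r ∷ rs) a ≡ replicate (count a r) 0 ++ map suc (Srow rs a)
Srow-∷ r rs a = cong (replicate (count a r) 0 ++_) (SrowFrom-suc 0 rs a)

Srow-sorted : ∀ t a → Sorted (Srow t a)
Srow-sorted []       a = []
Srow-sorted (r ∷ rs) a rewrite Srow-∷ r rs a =
  sorted-replicate-zero-++ (count a r) (sorted-map-suc (Srow-sorted rs a))

count-Srow : ∀ t a v → count v (Srow t a) ≡ count a (rowOf t v)
count-Srow []       a v       = refl
count-Srow (r ∷ rs) a zero    rewrite Srow-∷ r rs a = begin
  count 0 (replicate (count a r) 0 ++ map suc (Srow rs a))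
    ≡⟨ count-++ 0 (replicate (count a r) 0) _ ⟩
  count 0 (replicate (count a r) 0) + count 0 (map suc (Srow rs a))
    ≡⟨ cong₂ _+_ (count-replicate-≡ 0 (count a r)) (count-zero-map-suc (Srow rs a)) ⟩
  count a r + 0
    ≡⟨ +-identityʳ _ ⟩
  count a r ∎
  where open ≡-Reasoning
count-Srow (r ∷ rs) a (suc v) rewrite Srow-∷ r rs a = begin
  count (suc v) (replicate (count a r) 0 ++ map suc (Srow rs a))
    ≡⟨ count-++ (suc v) (replicate (count a r) 0) _ ⟩
  count (suc v) (replicate (count a r) 0) + count (suc v) (map suc (Srow rs a))
    ≡⟨ cong₂ _+_ (count-replicate-≢ (count a r) (λ ())) (count-map-suc v (Srow rs a)) ⟩
  count v (Srow rs a)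
    ≡⟨ count-Srow rs a v ⟩
  count a (rowOf rs v) ∎
  where open ≡-Reasoning

length-Srow : ∀ t a → length (Srow t a) ≡ cont t a
length-Srow []       a = refl
length-Srow (r ∷ rs) a rewrite Srow-∷ r rs a = begin
  length (replicate (count a r) 0 ++ map suc (Srow rs a))
    ≡⟨ length-++ (replicate (count a r) 0) ⟩
  length (replicate (count a r) 0) + length (map suc (Srow rs a))
    ≡⟨ cong₂ _+_ (length-replicate (count a r)) (trans (length-map suc (Srow rs a)) (length-Srow rs a)) ⟩
  count a r + cont rs a ∎
  where open ≡-Reasoning

word-applyUpTo-suc : ∀ (f : ℕ → List ℕ) n → word (applyUpTo f (suc n)) ≡ f n ++ word (applyUpTo f n)
word-applyUpTo-suc f n = begin
  concat (reverse (applyUpTo f (suc n)))    ≡⟨ cong (concat ∘′ reverse) (sym (applyUpTo-∷ʳ f n)) ⟩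
  concat (reverse (applyUpTo f n ∷ʳ f n))   ≡⟨ cong concat (reverse-++ (applyUpTo f n) (f n ∷ [])) ⟩
  f n ++ concat (reverse (applyUpTo f n))   ∎
  where open ≡-Reasoning

count-word : ∀ k t → count k (word t) ≡ cont t k
count-word k []       = refl
count-word k (r ∷ rs) = begin
  count k (concat (reverse (r ∷ rs)))          ≡⟨ cong (count k ∘′ concat) (unfold-reverse r rs) ⟩
  count k (concat (reverse rs ∷ʳ r))           ≡⟨ cong (count k) (sym (concat-++ (reverse rs) (r ∷ []))) ⟩
  count k (word rs ++ r ++ [])                 ≡⟨ count-++ k (word rs) (r ++ []) ⟩
  count k (word rs) + count k (r ++ [])        ≡⟨ cong₂ _+_ (count-word k rs) (cong (count k) (++-identityʳ r)) ⟩
  cont rs k + count k r                        ≡⟨ +-comm (cont rs k) (count k r) ⟩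
  cont (r ∷ rs) k                              ∎
  where open ≡-Reasoning

count-word-Srows : ∀ t a v → count v (word (applyUpTo (Srow t) a)) ≡ countBelow a (rowOf t v)
count-word-Srows t zero    v = sym (countBelow-none (rowOf t v) (All.universal (λ _ → z≤n) _))
count-word-Srows t (suc a) v = begin
  count v (word (applyUpTo (Srow t) (suc a)))
    ≡⟨ cong (count v) (word-applyUpTo-suc (Srow t) a) ⟩
  count v (Srow t a ++ word (applyUpTo (Srow t) a))
    ≡⟨ count-++ v (Srow t a) _ ⟩
  count v (Srow t a) + count v (word (applyUpTo (Srow t) a))
    ≡⟨ cong₂ _+_ (count-Srow t a v) (count-word-Srows t a v) ⟩
  count a (rowOf t v) + countBelow a (rowOf t v)
    ≡⟨ sym (countBelow-suc a (rowOf t v)) ⟩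
  countBelow (suc a) (rowOf t v) ∎
  where open ≡-Reasoning

uRow : List ℕ → ℕ → List ℕ
uRow β j = replicate (at β j) j

count-word-uRows-< : ∀ β j v → v < j → count v (word (applyUpTo (uRow β) j)) ≡ at β v
count-word-uRows-≥ : ∀ β j v → j ≤ v → count v (word (applyUpTo (uRow β) j)) ≡ 0

count-word-uRows-< β (suc j) v v<1+j = begin
  count v (word (applyUpTo (uRow β) (suc j)))
    ≡⟨ cong (count v) (word-applyUpTo-suc (uRow β) j) ⟩
  count v (uRow β j ++ word (applyUpTo (uRow β) j))
    ≡⟨ count-++ v (uRow β j) _ ⟩
  count v (uRow β j) + count v (word (applyUpTo (uRow β) j))
    ≡⟨ last-row (v ≟ j) ⟩
  at β v ∎
  where
  open ≡-Reasoning
  last-row : Dec (v ≡ j) → count v (uRow β j) + count v (word (applyUpTo (uRow β) j)) ≡ at β v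
  last-row (yes refl) = trans (cong₂ _+_ (count-replicate-≡ v (at β v)) (count-word-uRows-≥ β v v ≤-refl)) (+-identityʳ _)
  last-row (no v≢j)   =
    cong₂ _+_ (count-replicate-≢ (at β j) v≢j) (count-word-uRows-< β j v (≤∧≢⇒< (s≤s⁻¹ v<1+j) v≢j))
count-word-uRows-≥ β zero    v _     = refl
count-word-uRows-≥ β (suc j) v 1+j≤v = begin
  count v (word (applyUpTo (uRow β) (suc j)))
    ≡⟨ cong (count v) (word-applyUpTo-suc (uRow β) j) ⟩
  count v (uRow β j ++ word (applyUpTo (uRow β) j))
    ≡⟨ count-++ v (uRow β j) _ ⟩
  count v (uRow β j) + count v (word (applyUpTo (uRow β) j))
    ≡⟨ cong₂ _+_ (count-replicate-≢ (at β j) (λ v≡j → <-irrefl (sym v≡j) 1+j≤v))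
                 (count-word-uRows-≥ β j v (≤-trans (n≤1+n j) 1+j≤v)) ⟩
  0 ∎
  where open ≡-Reasoning

at-beyond : ∀ β v → length β ≤ v → at β v ≡ 0
at-beyond []      v       _     = refl
at-beyond (_ ∷ β) (suc v) 1+l≤v = at-beyond β v (s≤s⁻¹ 1+l≤v)

u-as-applyUpTo : ∀ β → u β ≡ applyUpTo (uRow β) (length β)
u-as-applyUpTo β = map-upTo (uRow β) (length β)

count-word-u : ∀ β v → count v (word (u β)) ≡ at β v
count-word-u β v rewrite u-as-applyUpTo β with v <? length β
... | yes v<l = count-word-uRows-< β (length β) v v<l
... | no v≮l  = trans (count-word-uRows-≥ β (length β) v (≮⇒≥ v≮l)) (sym (at-beyond β v (≮⇒≥ v≮l)))

-- Lattice words

LatticedAt : ℕ → List ℕ → Set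
LatticedAt k w = ∀ n → count (suc k) (drop n w) ≤ count k (drop n w)

drop-++-≤ : ∀ n (xs ys : List ℕ) → n ≤ length xs → drop n (xs ++ ys) ≡ drop n xs ++ ys
drop-++-≤ zero    xs       ys _       = refl
drop-++-≤ (suc n) (x ∷ xs) ys 1+n≤1+l = drop-++-≤ n xs ys (s≤s⁻¹ 1+n≤1+l)

drop-++-> : ∀ n (xs ys : List ℕ) → length xs < n → drop n (xs ++ ys) ≡ drop (n ∸ length xs) ys
drop-++-> (suc n) []       ys _     = refl
drop-++-> (suc n) (x ∷ xs) ys l<1+n = drop-++-> n xs ys (s<s⁻¹ l<1+n)

drop-length-++ : ∀ (xs ys : List ℕ) n → drop (length xs + n) (xs ++ ys) ≡ drop n ys
drop-length-++ []       ys n = refl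
drop-length-++ (x ∷ xs) ys n = drop-length-++ xs ys n

latticedAt-++ : ∀ {k} xs {ys} → LatticedAt k ys → count (suc k) (xs ++ ys) ≤ count k ys → LatticedAt k (xs ++ ys)
latticedAt-++ {k} xs {ys} L c n with n ≤? length xs
... | yes n≤l = begin
  count (suc k) (drop n (xs ++ ys))     ≤⟨ count-drop-≤ (suc k) n (xs ++ ys) ⟩
  count (suc k) (xs ++ ys)              ≤⟨ c ⟩
  count k ys                            ≤⟨ m≤n+m _ _ ⟩
  count k (drop n xs) + count k ys      ≡⟨ sym (count-++ k (drop n xs) ys) ⟩
  count k (drop n xs ++ ys)             ≡⟨ cong (count k) (sym (drop-++-≤ n xs ys n≤l)) ⟩
  count k (drop n (xs ++ ys))           ∎
  where open ≤-Reasoning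
... | no n≰l rewrite drop-++-> n xs ys (≰⇒> n≰l) = L (n ∸ length xs)

-- Witnessed by the suffix that starts just after the entries ≤ k of the sorted block xs.
latticedAt-sorted-++⁻ : ∀ {k} pre {xs} ys → Sorted xs → LatticedAt k (pre ++ xs ++ ys) →
                        count (suc k) (xs ++ ys) ≤ count k ys
latticedAt-sorted-++⁻ {k} pre {xs} ys sorted L with sorted-cut sorted k
... | m , m≤l , no-k , all-suc-k = begin
  count (suc k) (xs ++ ys)                     ≡⟨ count-++ (suc k) xs ys ⟩
  count (suc k) xs + count (suc k) ys          ≡⟨ cong (_+ _) (sym all-suc-k) ⟩
  count (suc k) (drop m xs) + count (suc k) ys ≡⟨ sym (count-++ (suc k) (drop m xs) ys) ⟩
  count (suc k) (drop m xs ++ ys)              ≡⟨ cong (count (suc k)) suffix ⟨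
  count (suc k) (drop n (pre ++ xs ++ ys))     ≤⟨ L n ⟩
  count k (drop n (pre ++ xs ++ ys))           ≡⟨ cong (count k) suffix ⟩
  count k (drop m xs ++ ys)                    ≡⟨ count-++ k (drop m xs) ys ⟩
  count k (drop m xs) + count k ys             ≡⟨ cong (_+ _) no-k ⟩
  count k ys                                   ∎
  where
  open ≤-Reasoning
  n : ℕ
  n = length pre + m
  suffix : drop n (pre ++ xs ++ ys) ≡ drop m xs ++ ys
  suffix = trans (drop-length-++ pre (xs ++ ys) m) (drop-++-≤ m xs ys m≤l)

module Blocks (f : ℕ → List ℕ) (base : List ℕ) where

  blocksWord : ℕ → List ℕ
  blocksWord a = word (applyUpTo f a) ++ base

  blocksWord-suc : ∀ a → blocksWord (suc a) ≡ f a ++ blocksWord a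
  blocksWord-suc a = trans (cong (_++ base) (word-applyUpTo-suc f a)) (++-assoc (f a) _ base)

  blocksWord-suffix : ∀ d a → ∃[ pre ] blocksWord (d + a) ≡ pre ++ blocksWord a
  blocksWord-suffix zero    a = [] , refl
  blocksWord-suffix (suc d) a =
    let pre , eq = blocksWord-suffix d a in
    f (d + a) ++ pre , trans (blocksWord-suc (d + a)) (trans (cong (f (d + a) ++_) eq) (sym (++-assoc (f (d + a)) pre _)))

  BlockCondition : ℕ → ℕ → Set
  BlockCondition k a = count (suc k) (blocksWord (suc a)) ≤ count k (blocksWord a)

  latticedAt-blocks⁺ : ∀ {k} n → LatticedAt k base → (∀ a → a < n → BlockCondition k a) → LatticedAt k (blocksWord n)
  latticedAt-blocks⁺ zero    L _ = L
  latticedAt-blocks⁺ {k} (suc n) L c = subst (LatticedAt k) (sym (blocksWord-suc n))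
    (latticedAt-++ (f n) (latticedAt-blocks⁺ n L (λ a a<n → c a (m<n⇒m<1+n a<n)))
                   (subst (λ w → count (suc k) w ≤ count k (blocksWord n)) (blocksWord-suc n) (c n ≤-refl)))

  latticedAt-blocks⁻ : ∀ {k n} → (∀ a → Sorted (f a)) → LatticedAt k (blocksWord n) → ∀ a → a < n → BlockCondition k a
  latticedAt-blocks⁻ {k} {n} sorted L a a<n with blocksWord-suffix (n ∸ suc a) (suc a)
  ... | pre , eq rewrite m∸n+n≡m a<n | eq | blocksWord-suc a =
    latticedAt-sorted-++⁻ pre (blocksWord a) (sorted a) L

latticedAt-[] : ∀ {k} → LatticedAt k []
latticedAt-[] zero    = z≤n
latticedAt-[] (suc n) = z≤n

u-latticed : ∀ β → IsPartition β → Latticed (word (u β))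
u-latticed β part k = subst (LatticedAt k) uWord (latticedAt-blocks⁺ (length β) latticedAt-[] (λ j _ → uCondition j))
  where
  open Blocks (uRow β) []
  uWord : blocksWord (length β) ≡ word (u β)
  uWord = trans (++-identityʳ _) (cong word (sym (u-as-applyUpTo β)))
  uCondition : ∀ j → BlockCondition k j
  uCondition j rewrite ++-identityʳ (word (applyUpTo (uRow β) (suc j))) | ++-identityʳ (word (applyUpTo (uRow β) j))
    with k <? j
  ... | yes k<j = subst₂ _≤_ (sym (count-word-uRows-< β (suc j) (suc k) (s≤s k<j))) (sym (count-word-uRows-< β j k k<j)) (part k)
  ... | no k≮j  = ≤-trans (≤-reflexive (count-word-uRows-≥ β (suc j) (suc k) (s≤s (≮⇒≥ k≮j)))) z≤n

-- S is an involution

at-applyUpTo-< : ∀ (g : ℕ → ℕ) n i → i < n → at (applyUpTo g n) i ≡ g i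
at-applyUpTo-< g (suc n) zero    _     = refl
at-applyUpTo-< g (suc n) (suc i) 1+i<1+n = at-applyUpTo-< (g ∘′ suc) n i (s<s⁻¹ 1+i<1+n)

rowOf-applyUpTo-< : ∀ (f : ℕ → List ℕ) n i → i < n → rowOf (applyUpTo f n) i ≡ f i
rowOf-applyUpTo-< f (suc n) zero    _       = refl
rowOf-applyUpTo-< f (suc n) (suc i) 1+i<1+n = rowOf-applyUpTo-< (f ∘′ suc) n i (s<s⁻¹ 1+i<1+n)

rowOf-applyUpTo-≥ : ∀ (f : ℕ → List ℕ) n i → n ≤ i → rowOf (applyUpTo f n) i ≡ []
rowOf-applyUpTo-≥ f zero    i       _       = refl
rowOf-applyUpTo-≥ f (suc n) (suc i) 1+n≤1+i = rowOf-applyUpTo-≥ (f ∘′ suc) n i (s≤s⁻¹ 1+n≤1+i)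

applyUpTo-rowOf : ∀ t → applyUpTo (rowOf t) (length t) ≡ t
applyUpTo-rowOf []       = refl
applyUpTo-rowOf (r ∷ rs) = cong (r ∷_) (applyUpTo-rowOf rs)

length-rowOf-Pointwise : ∀ {t ns} → Pointwise (λ r n → length r ≡ n) t ns → ∀ i → length (rowOf t i) ≡ at ns i
length-rowOf-Pointwise []       i       = refl
length-rowOf-Pointwise (e ∷ _)  zero    = e
length-rowOf-Pointwise (_ ∷ es) (suc i) = length-rowOf-Pointwise es i

length-rowOf : ∀ λ′ μ {t} → HasShape λ′ μ t → ∀ i → length (rowOf t i) ≡ at λ′ i ∸ at μ i
length-rowOf λ′ μ shape i rewrite length-rowOf-Pointwise shape i | map-upTo (λ i → at λ′ i ∸ at μ i) (length λ′)
  with i <? length λ′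
... | yes i<l = at-applyUpTo-< _ (length λ′) i i<l
... | no i≮l  = begin
  at (applyUpTo _ (length λ′)) i
    ≡⟨ at-beyond (applyUpTo _ (length λ′)) i (≤-trans (≤-reflexive (length-applyUpTo _ _)) (≮⇒≥ i≮l)) ⟩
  0                              ≡⟨ 0∸n≡0 (at μ i) ⟨
  0 ∸ at μ i                     ≡⟨ cong (_∸ at μ i) (at-beyond λ′ i (≮⇒≥ i≮l)) ⟨
  at λ′ i ∸ at μ i               ∎
  where open ≡-Reasoning

length-tableau : ∀ λ′ μ {t} → HasShape λ′ μ t → length t ≡ length λ′
length-tableau λ′ μ shape =
  trans (Pointwise-length shape) (trans (length-map (λ i → at λ′ i ∸ at μ i) (upTo (length λ′))) (length-upTo (length λ′)))

rowOf-sorted : ∀ {t} → RowStandard t → ∀ v → Sorted (rowOf t v)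
rowOf-sorted []       v       = []
rowOf-sorted (l ∷ _)  zero    = Linked⇒AllPairs ≤-trans l
rowOf-sorted (_ ∷ ls) (suc v) = rowOf-sorted ls v

count-rowOf-≤ : ∀ t v x → count x (rowOf t v) ≤ cont t x
count-rowOf-≤ []       v       x = z≤n
count-rowOf-≤ (r ∷ rs) zero    x = m≤m+n _ _
count-rowOf-≤ (r ∷ rs) (suc v) x = ≤-trans (count-rowOf-≤ rs v x) (m≤n+m _ _)

entries-< : ∀ α β t → (∀ k → at β k + cont t k ≡ at α k) → ∀ v → All (_< length α) (rowOf t v)
entries-< α β t content v = All-tabulate-count (rowOf t v) bounded
  where
  bounded : ∀ x → 0 < count x (rowOf t v) → x < length α
  bounded x 0<c with x <? length α
  ... | yes x<l = x<l
  ... | no x≮l  = ⊥-elim (<-irrefl refl (begin-strict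
    0                      <⟨ 0<c ⟩
    count x (rowOf t v)    ≤⟨ count-rowOf-≤ t v x ⟩
    cont t x               ≤⟨ m≤n+m _ _ ⟩
    at β x + cont t x      ≡⟨ content x ⟩
    at α x                 ≡⟨ at-beyond α x (≮⇒≥ x≮l) ⟩
    0                      ∎))
    where open ≤-Reasoning

S-as-applyUpTo : ∀ α t → S α t ≡ applyUpTo (Srow t) (length α)
S-as-applyUpTo α t = map-upTo (Srow t) (length α)

S-RSYT : ∀ λ′ μ α β t → IsSkew λ′ μ → RSYT λ′ μ α β t → RSYT α β λ′ μ (S α t)
S-RSYT λ′ μ α β t (_ , _ , μ≤λ) (shape , rowStd , content) = S-shape , S-rowStd , S-content
  where
  S-shape : HasShape α β (S α t)
  S-shape = Pointwise.map⁺ (Srow t) (λ i → at α i ∸ at β i) (Pointwise.refl (λ {a} → begin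
    length (Srow t a)         ≡⟨ length-Srow t a ⟩
    cont t a                  ≡⟨ m+n∸m≡n (at β a) (cont t a) ⟨
    at β a + cont t a ∸ at β a ≡⟨ cong (_∸ at β a) (content a) ⟩
    at α a ∸ at β a           ∎))
    where open ≡-Reasoning
  S-rowStd : RowStandard (S α t)
  S-rowStd = All.map⁺ (All.universal (λ a → AllPairs⇒Linked (Srow-sorted t a)) (upTo (length α)))
  S-content : ∀ k → at μ k + cont (S α t) k ≡ at λ′ k
  S-content k = begin
    at μ k + cont (S α t) k                                  ≡⟨ cong (at μ k +_) (count-word k (S α t)) ⟨
    at μ k + count k (word (S α t))                          ≡⟨ cong (λ s → at μ k + count k (word s)) (S-as-applyUpTo α t) ⟩
    at μ k + count k (word (applyUpTo (Srow t) (length α)))  ≡⟨ cong (at μ k +_) (count-word-Srows t (length α) k) ⟩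
    at μ k + countBelow (length α) (rowOf t k)               ≡⟨ cong (at μ k +_) (countBelow-all (rowOf t k) (entries-< α β t content k)) ⟩
    at μ k + length (rowOf t k)                              ≡⟨ cong (at μ k +_) (length-rowOf λ′ μ shape k) ⟩
    at μ k + (at λ′ k ∸ at μ k)                              ≡⟨ m+[n∸m]≡n (μ≤λ k) ⟩
    at λ′ k                                                  ∎
    where open ≡-Reasoning

count-Srow-S : ∀ α t → (∀ v → All (_< length α) (rowOf t v)) → ∀ k v → count v (Srow (S α t) k) ≡ count v (rowOf t k)
count-Srow-S α t bounded k v rewrite count-Srow (S α t) k v | S-as-applyUpTo α t with v <? length α
... | yes v<l rewrite rowOf-applyUpTo-< (Srow t) (length α) v v<l = count-Srow t v k
... | no v≮l  rewrite rowOf-applyUpTo-≥ (Srow t) (length α) v (≮⇒≥ v≮l) =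
  sym (count-≡0 (rowOf t k) (All.map (λ x<l v≡x → v≮l (subst (_< length α) (sym v≡x) x<l)) (bounded k)))

S-involutive : ∀ λ′ μ α β t → RSYT λ′ μ α β t → S λ′ (S α t) ≡ t
S-involutive λ′ μ α β t (shape , rowStd , content) = begin
  map (Srow (S α t)) (upTo (length λ′))   ≡⟨ map-cong sameRows (upTo (length λ′)) ⟩
  map (rowOf t) (upTo (length λ′))        ≡⟨ map-upTo (rowOf t) (length λ′) ⟩
  applyUpTo (rowOf t) (length λ′)         ≡⟨ cong (applyUpTo (rowOf t)) (length-tableau λ′ μ shape) ⟨
  applyUpTo (rowOf t) (length t)          ≡⟨ applyUpTo-rowOf t ⟩
  t                                       ∎
  where
  open ≡-Reasoning
  sameRows : ∀ k → Srow (S α t) k ≡ rowOf t k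
  sameRows k = sorted-unique (Srow-sorted (S α t) k) (rowOf-sorted rowStd k) (count-Srow-S α t (entries-< α β t content) k)

-- Column strictness

ShiftedStrict : ℕ → List ℕ → List ℕ → Set
ShiftedStrict d r r′ = ∀ i {x y} → nth r i ≡ just x → nth r′ (i + d) ≡ just y → x < y

nth-∷-+suc : ∀ (y : ℕ) ys i d → nth (y ∷ ys) (i + suc d) ≡ nth ys (i + d)
nth-∷-+suc y ys i d rewrite +-suc i d = refl

countBelow-sorted-tail : ∀ {a n y ys} → Sorted (y ∷ ys) → countBelow (suc a) (y ∷ ys) ≤ suc n → countBelow (suc a) ys ≤ n
countBelow-sorted-tail {a} {n} {y} {ys} (y≤ys ∷ _) c with y <? suc a
... | yes _  = s≤s⁻¹ c
... | no y≮ = ≤-trans (≤-reflexive (countBelow-none ys (All.map (≤-trans (≮⇒≥ y≮)) y≤ys))) z≤n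

countBelow-∷-mono : ∀ {a x y xs ys} → x < y → countBelow (suc a) ys ≤ countBelow a xs →
                    countBelow (suc a) (y ∷ ys) ≤ countBelow a (x ∷ xs)
countBelow-∷-mono {a} {x} {y} x<y c with y <? suc a | x <? a
... | yes _     | yes _  = s≤s c
... | yes y<1+a | no x≮a = ⊥-elim (x≮a (<-≤-trans x<y (s≤s⁻¹ y<1+a)))
... | no _      | yes _  = m≤n⇒m≤1+n c
... | no _      | no _   = c

shiftedStrict⇒countBelow : ∀ d r r′ → length r′ ≤ d + length r → ShiftedStrict d r r′ →
                           ∀ a → countBelow (suc a) r′ ≤ d + countBelow a r
shiftedStrict⇒countBelow d       r        []       _ _ a = z≤n
shiftedStrict⇒countBelow (suc d) r        (y ∷ ys) l s a =
  ≤-trans (countBelow-∷-≤ (suc a) y ys)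
          (s≤s (shiftedStrict⇒countBelow d r ys (s≤s⁻¹ l) (λ i ex ey → s i ex (trans (nth-∷-+suc y ys i d) ey)) a))
shiftedStrict⇒countBelow zero    []       (y ∷ ys) () s a
shiftedStrict⇒countBelow zero    (x ∷ xs) (y ∷ ys) l s a =
  countBelow-∷-mono (s 0 refl refl) (shiftedStrict⇒countBelow zero xs ys (s≤s⁻¹ l) (λ i → s (suc i)) a)

countBelow-head-< : ∀ {x y xs ys} → Sorted (x ∷ xs) → countBelow (suc y) (y ∷ ys) ≤ countBelow y (x ∷ xs) → x < y
countBelow-head-< {x} {y} {xs} {ys} (x≤xs ∷ _) c with y ≤? x
... | no y≰x  = ≰⇒> y≰x
... | yes y≤x = ⊥-elim (<-irrefl refl (begin-strict
  0                               <⟨ z<s ⟩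
  suc (countBelow (suc y) ys)     ≡⟨ countBelow-∷-< ys (n<1+n y) ⟨
  countBelow (suc y) (y ∷ ys)     ≤⟨ c ⟩
  countBelow y (x ∷ xs)           ≡⟨ countBelow-none (x ∷ xs) (y≤x ∷ All.map (≤-trans y≤x) x≤xs) ⟩
  0                               ∎))
  where open ≤-Reasoning

countBelow⇒shiftedStrict : ∀ A d r r′ → Sorted r → Sorted r′ → All (_< A) r′ →
                           (∀ a → a < A → countBelow (suc a) r′ ≤ d + countBelow a r) → ShiftedStrict d r r′
countBelow⇒shiftedStrict A d       r        []       _  _   _          c i ex ()
countBelow⇒shiftedStrict A (suc d) r        (y ∷ ys) sr sr′@(_ ∷ sys) (_ ∷ ys<A) c i ex ey =
  countBelow⇒shiftedStrict A d r ys sr sys ys<A (λ a a<A → countBelow-sorted-tail sr′ (c a a<A))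
                           i ex (trans (sym (nth-∷-+suc y ys i d)) ey)
countBelow⇒shiftedStrict A zero    []       (y ∷ ys) _  _   _          c i () ey
countBelow⇒shiftedStrict A zero    (x ∷ xs) (y ∷ ys) sr _   (y<A ∷ _)  c zero refl refl =
  countBelow-head-< sr (c y y<A)
countBelow⇒shiftedStrict A zero    (x ∷ xs) (y ∷ ys) (_ ∷ sxs) sr′@(_ ∷ sys) (_ ∷ ys<A) c (suc i) ex ey =
  countBelow⇒shiftedStrict A zero xs ys sxs sys ys<A
    (λ a a<A → countBelow-sorted-tail sr′ (≤-trans (c a a<A) (countBelow-∷-≤ a x xs))) i ex ey

nth-just⇒< : ∀ (xs : List ℕ) i {x} → nth xs i ≡ just x → i < length xs
nth-just⇒< (_ ∷ xs) zero    _  = z<s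
nth-just⇒< (_ ∷ xs) (suc i) eq = s≤s (nth-just⇒< xs i eq)

<⇒nth-just : ∀ (xs : List ℕ) i → i < length xs → ∃[ x ] nth xs i ≡ just x
<⇒nth-just (y ∷ xs) zero    _       = y , refl
<⇒nth-just (y ∷ xs) (suc i) 1+i<1+l = <⇒nth-just xs i (s<s⁻¹ 1+i<1+l)

rowOf-nth-just : ∀ t i {r} → nth t i ≡ just r → rowOf t i ≡ r
rowOf-nth-just (_ ∷ _) zero    refl = refl
rowOf-nth-just (_ ∷ t) (suc i) eq   = rowOf-nth-just t i eq

rowOf-nth-nothing : ∀ t i → nth t i ≡ nothing → rowOf t i ≡ []
rowOf-nth-nothing []      i       _  = refl
rowOf-nth-nothing (_ ∷ t) (suc i) eq = rowOf-nth-nothing t i eq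

entry-just⁻ : ∀ μ t i j {x} → entry μ t i j ≡ just x → at μ i ≤ j × nth (rowOf t i) (j ∸ at μ i) ≡ just x
entry-just⁻ μ t i j e with nth t i in eq
... | nothing with () ← e
... | just r with at μ i ≤? j
...   | yes μᵢ≤j = μᵢ≤j , trans (cong (λ r′ → nth r′ (j ∸ at μ i)) (rowOf-nth-just t i eq)) e
...   | no _ with () ← e

entry-just⁺ : ∀ μ t i j {x} → at μ i ≤ j → nth (rowOf t i) (j ∸ at μ i) ≡ just x → entry μ t i j ≡ just x
entry-just⁺ μ t i j μᵢ≤j e with nth t i in eq
... | nothing with () ← trans (sym (cong (λ r′ → nth r′ (j ∸ at μ i)) (rowOf-nth-nothing t i eq))) e
... | just r with at μ i ≤? j
...   | yes _    = trans (sym (cong (λ r′ → nth r′ (j ∸ at μ i)) (rowOf-nth-just t i eq))) e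
...   | no μᵢ≰j = ⊥-elim (μᵢ≰j μᵢ≤j)

at-antitone : ∀ β → IsPartition β → ∀ {i i′} → i ≤ i′ → at β i′ ≤ at β i
at-antitone β part {i} {i′} i≤i′ = subst (λ n → at β n ≤ at β i) (m∸n+n≡m i≤i′) (go (i′ ∸ i))
  where
  go : ∀ d → at β (d + i) ≤ at β i
  go zero    = ≤-refl
  go (suc d) = ≤-trans (part (d + i)) (go d)

entry-between : ∀ λ′ μ {t} → IsSkew λ′ μ → HasShape λ′ μ t → ∀ {i i″ i′ j x y} → i ≤ i″ → i″ ≤ i′ →
                entry μ t i j ≡ just x → entry μ t i′ j ≡ just y → ∃[ z ] entry μ t i″ j ≡ just z
entry-between λ′ μ {t} (λ-part , μ-part , μ≤λ) shape {i} {i″} {i′} {j} i≤i″ i″≤i′ ex ey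
  with entry-just⁻ μ t i j ex | entry-just⁻ μ t i′ j ey
... | μᵢ≤j , _ | μᵢ′≤j , eyᵣ =
  let z , ez = <⇒nth-just (rowOf t i″) _ index< in z , entry-just⁺ μ t i″ j μᵢ″≤j ez
  where
  μᵢ″≤j : at μ i″ ≤ j
  μᵢ″≤j = ≤-trans (at-antitone μ μ-part i≤i″) μᵢ≤j
  j<λᵢ′ : j < at λ′ i′
  j<λᵢ′ = begin-strict
    j                                    ≡⟨ m∸n+n≡m μᵢ′≤j ⟨
    j ∸ at μ i′ + at μ i′                <⟨ +-monoˡ-< (at μ i′) (subst (j ∸ at μ i′ <_) (length-rowOf λ′ μ shape i′)
                                                                      (nth-just⇒< (rowOf t i′) _ eyᵣ)) ⟩
    at λ′ i′ ∸ at μ i′ + at μ i′         ≡⟨ m∸n+n≡m (μ≤λ i′) ⟩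
    at λ′ i′                             ∎
    where open ≤-Reasoning
  index< : j ∸ at μ i″ < length (rowOf t i″)
  index< = subst (j ∸ at μ i″ <_) (sym (length-rowOf λ′ μ shape i″))
                 (∸-monoˡ-< (<-≤-trans j<λᵢ′ (at-antitone λ′ λ-part i″≤i′)) μᵢ″≤j)

AdjacentStrict : List ℕ → Tableau → Set
AdjacentStrict μ t = ∀ k j {x y} → entry μ t k j ≡ just x → entry μ t (suc k) j ≡ just y → x < y

adjacentStrict⇒columnStrict : ∀ λ′ μ {t} → IsSkew λ′ μ → HasShape λ′ μ t → AdjacentStrict μ t → ColumnStrict μ t
adjacentStrict⇒columnStrict λ′ μ {t} skew shape adj i i′ j x y i<i′ ex ey = go i′ i<i′ ey
  where
  go : ∀ i′ {y} → i < i′ → entry μ t i′ j ≡ just y → x < y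
  go (suc i″) i<1+i″ ey with m≤n⇒m<n∨m≡n (s≤s⁻¹ i<1+i″)
  ... | inj₂ refl = adj i j ex ey
  ... | inj₁ i<i″ =
    let z , ez = entry-between λ′ μ skew shape (<⇒≤ i<i″) (n≤1+n i″) ex ey in
    <-trans (go i″ i<i″ ez) (adj i″ j ez ey)

∸-split : ∀ j {a b} → b ≤ a → a ≤ j → j ∸ b ≡ (j ∸ a) + (a ∸ b)
∸-split j {a} {b} b≤a a≤j = trans (cong (_∸ b) (sym (m∸n+n≡m a≤j))) (+-∸-assoc (j ∸ a) b≤a)

-- Position i of row k and position i + gap μ k of row k+1 lie in the same column.
gap : List ℕ → ℕ → ℕ
gap μ k = at μ k ∸ at μ (suc k)

columnStrict⇒shiftedStrict : ∀ μ t → IsPartition μ → ColumnStrict μ t →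
                             ∀ k → ShiftedStrict (gap μ k) (rowOf t k) (rowOf t (suc k))
columnStrict⇒shiftedStrict μ t μ-part cs k i {x} {y} ex ey =
  cs k (suc k) (at μ k + i) x y (n<1+n k)
     (entry-just⁺ μ t k _ (m≤m+n _ _) (subst (λ n → nth (rowOf t k) n ≡ just x) (sym (m+n∸m≡n (at μ k) i)) ex))
     (entry-just⁺ μ t (suc k) _ (≤-trans (μ-part k) (m≤m+n _ _))
                  (subst (λ n → nth (rowOf t (suc k)) n ≡ just y) (sym shift) ey))
  where
  shift : at μ k + i ∸ at μ (suc k) ≡ i + gap μ k
  shift = trans (∸-split (at μ k + i) (μ-part k) (m≤m+n _ _)) (cong (_+ gap μ k) (m+n∸m≡n (at μ k) i))

shiftedStrict⇒adjacentStrict : ∀ μ t → IsPartition μ →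
                               (∀ k → ShiftedStrict (gap μ k) (rowOf t k) (rowOf t (suc k))) → AdjacentStrict μ t
shiftedStrict⇒adjacentStrict μ t μ-part s k j {x} {y} ex ey with entry-just⁻ μ t k j ex | entry-just⁻ μ t (suc k) j ey
... | μₖ≤j , exᵣ | _ , eyᵣ =
  s k (j ∸ at μ k) exᵣ (subst (λ n → nth (rowOf t (suc k)) n ≡ just y) (∸-split j (μ-part k) μₖ≤j) eyᵣ)

CountCondition : List ℕ → ℕ → Tableau → Set
CountCondition μ A t = ∀ k a → a < A →
  countBelow (suc a) (rowOf t (suc k)) + at μ (suc k) ≤ countBelow a (rowOf t k) + at μ k

+-cancel-∸-≤ : ∀ x y {m n} → m ≤ n → (x + m ≤ y + n ⇔ x ≤ (n ∸ m) + y)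
+-cancel-∸-≤ x y {m} {n} m≤n = mk⇔
  (λ h → +-cancelʳ-≤ m x _ (subst (x + m ≤_) (sym split) h))
  (λ h → subst (x + m ≤_) split (+-monoˡ-≤ m h))
  where
  open ≡-Reasoning
  split : n ∸ m + y + m ≡ y + n
  split = begin
    n ∸ m + y + m    ≡⟨ cong (_+ m) (+-comm (n ∸ m) y) ⟩
    y + (n ∸ m) + m  ≡⟨ +-assoc y (n ∸ m) m ⟩
    y + (n ∸ m + m)  ≡⟨ cong (y +_) (m∸n+n≡m m≤n) ⟩
    y + n            ∎

columnStrict⇔countCondition : ∀ λ′ μ α β t → IsSkew λ′ μ → RSYT λ′ μ α β t →
                              ColumnStrict μ t ⇔ CountCondition μ (length α) t
columnStrict⇔countCondition λ′ μ α β t skew@(λ-part , μ-part , μ≤λ) (shape , rowStd , content) = mk⇔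
  (λ cs k a _ → Equivalence.from (gapped k a)
     (shiftedStrict⇒countBelow (gap μ k) (rowOf t k) (rowOf t (suc k)) (row-lengths k)
                               (columnStrict⇒shiftedStrict μ t μ-part cs k) a))
  (λ c → adjacentStrict⇒columnStrict λ′ μ skew shape (shiftedStrict⇒adjacentStrict μ t μ-part (λ k →
     countBelow⇒shiftedStrict (length α) (gap μ k) (rowOf t k) (rowOf t (suc k))
       (rowOf-sorted rowStd k) (rowOf-sorted rowStd (suc k)) (entries-< α β t content (suc k))
       (λ a a<A → Equivalence.to (gapped k a) (c k a a<A)))))
  where
  gapped : ∀ k a → (countBelow (suc a) (rowOf t (suc k)) + at μ (suc k) ≤ countBelow a (rowOf t k) + at μ k)
                  ⇔ (countBelow (suc a) (rowOf t (suc k)) ≤ gap μ k + countBelow a (rowOf t k))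
  gapped k a = +-cancel-∸-≤ (countBelow (suc a) (rowOf t (suc k))) (countBelow a (rowOf t k)) (μ-part k)
  row-lengths : ∀ k → length (rowOf t (suc k)) ≤ gap μ k + length (rowOf t k)
  row-lengths k = begin
    length (rowOf t (suc k))              ≡⟨ length-rowOf λ′ μ shape (suc k) ⟩
    at λ′ (suc k) ∸ at μ (suc k)          ≤⟨ ∸-monoˡ-≤ (at μ (suc k)) (λ-part k) ⟩
    at λ′ k ∸ at μ (suc k)                ≡⟨ ∸-split (at λ′ k) (μ-part k) (μ≤λ k) ⟩
    at λ′ k ∸ at μ k + gap μ k            ≡⟨ +-comm _ (gap μ k) ⟩
    gap μ k + (at λ′ k ∸ at μ k)          ≡⟨ cong (gap μ k +_) (length-rowOf λ′ μ shape k) ⟨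
    gap μ k + length (rowOf t k)          ∎
    where open ≤-Reasoning

latticed⇔countCondition : ∀ μ A t → IsPartition μ →
                          Latticed (word (applyUpTo (Srow t) A) ++ word (u μ)) ⇔ CountCondition μ A t
latticed⇔countCondition μ A t μ-part = mk⇔
  (λ L k a a<A → subst id (condition≡ k a) (latticedAt-blocks⁻ (Srow-sorted t) (L k) a a<A))
  (λ c k → latticedAt-blocks⁺ A (u-latticed μ μ-part k) (λ a a<A → subst id (sym (condition≡ k a)) (c k a a<A)))
  where
  open Blocks (Srow t) (word (u μ))
  count-blocksWord : ∀ a v → count v (blocksWord a) ≡ countBelow a (rowOf t v) + at μ v
  count-blocksWord a v = trans (count-++ v (word (applyUpTo (Srow t) a)) (word (u μ)))
                               (cong₂ _+_ (count-word-Srows t a v) (count-word-u μ v))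
  condition≡ : ∀ k a → BlockCondition k a ≡
               (countBelow (suc a) (rowOf t (suc k)) + at μ (suc k) ≤ countBelow a (rowOf t k) + at μ k)
  condition≡ k a = cong₂ _≤_ (count-blocksWord (suc a) (suc k)) (count-blocksWord a k)

columnStrict⇔latticed : ∀ λ′ μ α β t → IsSkew λ′ μ → RSYT λ′ μ α β t →
                        ColumnStrict μ t ⇔ Latticed (word (S α t) ++ word (u μ))
columnStrict⇔latticed λ′ μ α β t skew rsyt
  rewrite S-as-applyUpTo α t =
  ⇔-trans (columnStrict⇔countCondition λ′ μ α β t skew rsyt)
          (⇔-sym (latticed⇔countCondition μ (length α) t (proj₁ (proj₂ skew))))

BijOn-restrict : ∀ {A : Set} {P Q P′ Q′ : A → Set} {f g : A → A} → BijOn P Q f g →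
                 (∀ x → P′ x → P x) → (∀ y → Q′ y → Q y) →
                 (∀ x → P′ x → Q′ (f x)) → (∀ y → Q′ y → P′ (g y)) → BijOn P′ Q′ f g
BijOn-restrict (_ , _ , gf , fg) P′⊆P Q′⊆Q f-maps g-maps =
  f-maps , g-maps , (λ x p′ → gf x (P′⊆P x p′)) , (λ y q′ → fg y (Q′⊆Q y q′))

S-bijOn-RSYT : ∀ λ′ μ α β → IsSkew λ′ μ → IsSkew α β → BijOn (RSYT λ′ μ α β) (RSYT α β λ′ μ) (S α) (S λ′)
S-bijOn-RSYT λ′ μ α β skew₁ skew₂ =
  (λ t → S-RSYT λ′ μ α β t skew₁) , (λ s → S-RSYT α β λ′ μ s skew₂) ,
  S-involutive λ′ μ α β , S-involutive α β λ′ μ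

S-latticed : ∀ λ′ μ α β t → IsSkew λ′ μ → RSYT λ′ μ α β t →
             ColumnStrict μ t → Latticed (word (S α t) ++ word (u μ))
S-latticed λ′ μ α β t skew rsyt = Equivalence.to (columnStrict⇔latticed λ′ μ α β t skew rsyt)

S-columnStrict : ∀ λ′ μ α β t → IsSkew λ′ μ → IsSkew α β → RSYT λ′ μ α β t →
                 Latticed (word t ++ word (u β)) → ColumnStrict β (S α t)
S-columnStrict λ′ μ α β t skew₁ skew₂ rsyt L =
  Equivalence.from (columnStrict⇔latticed α β λ′ μ (S α t) skew₂ (S-RSYT λ′ μ α β t skew₁ rsyt))
    (subst (λ s → Latticed (word s ++ word (u β))) (sym (S-involutive λ′ μ α β t rsyt)) L)

S-SSYTL : ∀ λ′ μ α β t → IsSkew λ′ μ → IsSkew α β → SSYTL λ′ μ α β t → SSYTL α β λ′ μ (S α t)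
S-SSYTL λ′ μ α β t skew₁ skew₂ ((rsyt , L) , cs) =
  (S-RSYT λ′ μ α β t skew₁ rsyt , S-latticed λ′ μ α β t skew₁ rsyt cs) ,
  S-columnStrict λ′ μ α β t skew₁ skew₂ rsyt L

lemma7p2 : (λ′ μ α β : List ℕ) → IsSkew λ′ μ → IsSkew α β → size λ′ μ ≡ size α β →
    BijOn (RSYT λ′ μ α β) (RSYT α β λ′ μ) (S α) (S λ′)
    × BijOn (SSYT λ′ μ α β) (RSYTL α β λ′ μ) (S α) (S λ′)
    × BijOn (SSYTL λ′ μ α β) (SSYTL α β λ′ μ) (S α) (S λ′)
lemma7p2 λ′ μ α β skew₁ skew₂ _ =
  bij
  , BijOn-restrict bij (λ _ → proj₁) (λ _ → proj₁)
      (λ t (rsyt , cs) → S-RSYT λ′ μ α β t skew₁ rsyt , S-latticed λ′ μ α β t skew₁ rsyt cs)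
      (λ s (rsyt , L) → S-RSYT α β λ′ μ s skew₂ rsyt , S-columnStrict α β λ′ μ s skew₂ skew₁ rsyt L)
  , BijOn-restrict bij (λ _ → proj₁ ∘′ proj₁) (λ _ → proj₁ ∘′ proj₁)
      (λ t → S-SSYTL λ′ μ α β t skew₁ skew₂) (λ s → S-SSYTL α β λ′ μ s skew₂ skew₁)
  where
  bij : BijOn (RSYT λ′ μ α β) (RSYT α β λ′ μ) (S α) (S λ′)
  bij = S-bijOn-RSYT λ′ μ α β skew₁ skew₂
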